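{- $\beta_P(2)=2$.
   Context: For a finite set $X$ and a probability mass $\mu$ on $\binom{X}{2}$ (the 2-element subsets of $X$), write $\mu(xy)=\mu(\{x,y\})$ and $\bar\mu(x)=\sum_{y\in X\setminus\{x\}}\mu(xy)$. Let $(X)_m$ be the set of tuples in $X^m$ with distinct entries. Define $\beta_P(\mu;m)=\sum_{\mathbf{x}\in (X)_m}\bar\mu(x_1)\bigl(\prod_{i=1}^{m-1}\mu(x_ix_{i+1})\bigr)\bar\mu(x_m)$ and $\beta_P(m)=\sup\beta_P(\mu;m)$, over all finite sets $X$ and probability masses $\mu$ on $\binom{X}{2}$.
   Formalization: The probability masses μ on $\binom{X}{2}$ take only rational values. -}

module Defs where

open import Data.Nat using (ℕ; zero; suc)
open import Data.Fin using (Fin; zero; suc; _<?_; _≟_)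
open import Data.Rational using (ℚ; 0ℚ; 1ℚ; _+_; _*_; _≤_; _<_)
open import Relation.Nullary using (does)
open import Data.Bool using (if_then_else_)
open import Data.Product using (_×_)

Σ[_]_ : (n : ℕ) → (Fin n → ℚ) → ℚ
Σ[ zero ] f = 0ℚ
Σ[ suc n ] f = f zero + Σ[ n ] (λ i → f (suc i))

-- A mass on the 2-subsets of X = Fin n is given by a table μ : Fin n → Fin n → ℚ,
-- where the mass of {x,y} with x < y is the entry μ x y (entries with x ≥ y are ignored).
Mass : ℕ → Set
Mass n = Fin n → Fin n → ℚ

edge : ∀ {n} → Mass n → Fin n → Fin n → ℚ
edge μ x y = if does (x <? y) then μ x y else μ y x

ifDistinct : ∀ {n} → Fin n → Fin n → ℚ → ℚ
ifDistinct x y q = if does (x ≟ y) then 0ℚ else q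

IsProbMass : ∀ n → Mass n → Set
IsProbMass n μ =
  (∀ (x y : Fin n) → Data.Fin._<_ x y → 0ℚ ≤ μ x y)
  × (Σ[ n ] (λ x → Σ[ n ] (λ y → if does (x <? y) then μ x y else 0ℚ)) ≡ 1ℚ)
  where open import Relation.Binary.PropositionalEquality using (_≡_)

μbar : ∀ {n} → Mass n → Fin n → ℚ
μbar {n} μ x = Σ[ n ] (λ y → ifDistinct x y (edge μ x y))

βP2 : ∀ n → Mass n → ℚ
βP2 n μ = Σ[ n ] (λ x₁ → Σ[ n ] (λ x₂ →
            ifDistinct x₁ x₂ (μbar μ x₁ * edge μ x₁ x₂ * μbar μ x₂)))

2ℚ : ℚ
2ℚ = 1ℚ + 1ℚ

{-# OPTIONS --safe #-}
module Submission where

-- μ̄(x) is the total mass of the edges through x, so 0 ≤ μ̄(x) ≤ 1 and every summand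
-- μ̄(x₁) μ(x₁x₂) μ̄(x₂) of β_P(μ;2) is at most μ(x₁x₂). Summing μ(x₁x₂) over ordered pairs
-- counts every edge twice (the handshake lemma Σₓ μ̄(x) = 2), hence β_P(μ;2) ≤ 2.
-- A single edge of mass 1 has μ̄ = 1 at both ends and attains the bound.

open import Defs
open import Data.Nat using (ℕ; suc)
open import Data.Rational using (ℚ; 0ℚ; _<_; _≤_; _-_)
open import Data.Product using (_×_; Σ)

open import Data.Bool using (if_then_else_)
open import Data.Fin using (Fin; zero; suc; _<?_; _≟_; punchIn)
open import Data.Fin.Properties using (<-cmp; <-irrefl; <⇒≢)
open import Data.Product using (_,_; proj₁; proj₂)
open import Data.Rational using (1ℚ; _+_; _*_; nonNegative)
open import Data.Rational.Properties
  using ( ≤-refl; +-mono-≤; +-monoʳ-≤; +-monoʳ-<; neg-antimono-<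
        ; +-identityˡ; +-identityʳ; *-identityˡ; *-identityʳ
        ; *-monoˡ-≤-nonNeg; *-monoʳ-≤-nonNeg; nonNegative⁻¹
        ; +-0-commutativeMonoid; module ≤-Reasoning )
open import Data.Vec.Functional using (removeAt)
open import Function using (_∘_)
open import Relation.Binary.Definitions using (tri<; tri≈; tri>)
open import Relation.Binary.PropositionalEquality
  using (_≡_; refl; sym; trans; cong; cong₂; subst; subst₂; ≢-sym; module ≡-Reasoning)
open import Relation.Nullary using (does; yes; no)
open import Relation.Nullary.Decidable using (dec-true; dec-false)

open import Algebra.Properties.CommutativeMonoid.Sum +-0-commutativeMonoid
  using (sum; sum-cong-≗; sum-remove; ∑-distrib-+; ∑-comm)

private
  variable
    n : ℕ

Σ≡sum : (f : Fin n → ℚ) → Σ[ n ] f ≡ sum f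
Σ≡sum {ℕ.zero} f = refl
Σ≡sum {suc n}  f = cong (f zero +_) (Σ≡sum (f ∘ suc))

sum-nonneg : (f : Fin n → ℚ) → (∀ i → 0ℚ ≤ f i) → 0ℚ ≤ sum f
sum-nonneg {ℕ.zero} f f≥0 = ≤-refl
sum-nonneg {suc n}  f f≥0 = +-mono-≤ (f≥0 zero) (sum-nonneg (f ∘ suc) (f≥0 ∘ suc))

sum-mono-≤ : (f g : Fin n → ℚ) → (∀ i → f i ≤ g i) → sum f ≤ sum g
sum-mono-≤ {ℕ.zero} f g f≤g = ≤-refl
sum-mono-≤ {suc n}  f g f≤g = +-mono-≤ (f≤g zero) (sum-mono-≤ (f ∘ suc) (g ∘ suc) (f≤g ∘ suc))

Σ-mono-≤ : (f g : Fin n → ℚ) → (∀ i → f i ≤ g i) → Σ[ n ] f ≤ Σ[ n ] g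
Σ-mono-≤ f g f≤g = subst₂ _≤_ (sym (Σ≡sum f)) (sym (Σ≡sum g)) (sum-mono-≤ f g f≤g)

term≤sum : (f : Fin n → ℚ) → (∀ i → 0ℚ ≤ f i) → ∀ i → f i ≤ sum f
term≤sum {suc n} f f≥0 i = begin
  f i                          ≡⟨ +-identityʳ (f i) ⟨
  f i + 0ℚ                     ≤⟨ +-monoʳ-≤ (f i) (sum-nonneg (removeAt f i) (f≥0 ∘ punchIn i)) ⟩
  f i + sum (removeAt f i)     ≡⟨ sum-remove f ⟨
  sum f                        ∎
  where open ≤-Reasoning

row+column≤sum : (h : Fin n → Fin n → ℚ) → (∀ a b → 0ℚ ≤ h a b) → ∀ x → h x x ≡ 0ℚ →
                 sum (h x) + sum (λ a → h a x) ≤ sum (λ a → sum (h a))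
row+column≤sum {suc n} h h≥0 x hxx≡0 = begin
  sum (h x) + sum column                               ≡⟨ cong (sum (h x) +_) (sum-remove column) ⟩
  sum (h x) + (h x x + sum (removeAt column x))        ≡⟨ cong (λ c → sum (h x) + (c + sum (removeAt column x))) hxx≡0 ⟩
  sum (h x) + (0ℚ + sum (removeAt column x))           ≡⟨ cong (sum (h x) +_) (+-identityˡ _) ⟩
  sum (h x) + sum (removeAt column x)                  ≤⟨ +-monoʳ-≤ (sum (h x)) (sum-mono-≤ _ _ entry≤row) ⟩
  sum (h x) + sum (removeAt rows x)                    ≡⟨ sum-remove rows ⟨
  sum rows                                             ∎
  where
  open ≤-Reasoning
  column rows : Fin (suc n) → ℚ
  column a = h a x
  rows a = sum (h a)
  entry≤row : ∀ j → h (punchIn x j) x ≤ sum (h (punchIn x j))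
  entry≤row j = term≤sum (h (punchIn x j)) (h≥0 (punchIn x j)) x

p*q*r≤q : ∀ {p q r} → 0ℚ ≤ p → p ≤ 1ℚ → 0ℚ ≤ q → 0ℚ ≤ r → r ≤ 1ℚ → p * q * r ≤ q
p*q*r≤q {p} {q} {r} _ p≤1 q≥0 r≥0 r≤1 = begin
  p * q * r    ≤⟨ *-monoʳ-≤-nonNeg r {{nonNegative r≥0}} (*-monoʳ-≤-nonNeg q {{nonNegative q≥0}} p≤1) ⟩
  1ℚ * q * r   ≡⟨ cong (_* r) (*-identityˡ q) ⟩
  q * r        ≤⟨ *-monoˡ-≤-nonNeg q {{nonNegative q≥0}} r≤1 ⟩
  q * 1ℚ       ≡⟨ *-identityʳ q ⟩
  q            ∎
  where open ≤-Reasoning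

-- μ with its ignored entries (x ≥ y) replaced by 0, so that μ(xy) = upper μ x y + upper μ y x.
upper : Mass n → Fin n → Fin n → ℚ
upper μ x y = if does (x <? y) then μ x y else 0ℚ

module _ (μ : Mass n) where

  upper-diagonal : ∀ x → upper μ x x ≡ 0ℚ
  upper-diagonal x rewrite dec-false (x <? x) (<-irrefl refl) = refl

  ifDistinct-edge≡upper+upper : ∀ x y → ifDistinct x y (edge μ x y) ≡ upper μ x y + upper μ y x
  ifDistinct-edge≡upper+upper x y with <-cmp x y
  ... | tri< x<y _ y≮x
    rewrite dec-false (x ≟ y) (<⇒≢ x<y) | dec-true (x <? y) x<y | dec-false (y <? x) y≮x
    = sym (+-identityʳ (μ x y))
  ... | tri≈ _ refl _
    rewrite dec-true (x ≟ x) refl | upper-diagonal x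
    = sym (+-identityʳ 0ℚ)
  ... | tri> x≮y _ y<x
    rewrite dec-false (x ≟ y) (≢-sym (<⇒≢ y<x)) | dec-false (x <? y) x≮y | dec-true (y <? x) y<x
    = sym (+-identityˡ (μ y x))

  totalMass : ℚ
  totalMass = Σ[ n ] (λ x → Σ[ n ] (upper μ x))

  totalMass≡sum : totalMass ≡ sum (λ x → sum (upper μ x))
  totalMass≡sum = trans (Σ≡sum (λ x → Σ[ n ] (upper μ x))) (sum-cong-≗ (Σ≡sum ∘ upper μ))

  μbar≡row+column : ∀ x → μbar μ x ≡ sum (upper μ x) + sum (λ a → upper μ a x)
  μbar≡row+column x = begin
    μbar μ x
      ≡⟨ Σ≡sum (λ y → ifDistinct x y (edge μ x y)) ⟩
    sum (λ y → ifDistinct x y (edge μ x y))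
      ≡⟨ sum-cong-≗ (ifDistinct-edge≡upper+upper x) ⟩
    sum (λ y → upper μ x y + upper μ y x)
      ≡⟨ ∑-distrib-+ (upper μ x) (λ y → upper μ y x) ⟩
    sum (upper μ x) + sum (λ a → upper μ a x)
      ∎
    where open ≡-Reasoning

  handshake : Σ[ n ] (μbar μ) ≡ totalMass + totalMass
  handshake = begin
    Σ[ n ] (μbar μ)                                  ≡⟨ Σ≡sum (μbar μ) ⟩
    sum (μbar μ)                                     ≡⟨ sum-cong-≗ μbar≡row+column ⟩
    sum (λ x → sum (upper μ x) + sum (λ a → upper μ a x))
                                                     ≡⟨ ∑-distrib-+ (λ x → sum (upper μ x)) _ ⟩
    sum (λ x → sum (upper μ x)) + sum (λ x → sum (λ a → upper μ a x))
                                                     ≡⟨ cong (sum (λ x → sum (upper μ x)) +_) (∑-comm (upper μ)) ⟨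
    sum (λ x → sum (upper μ x)) + sum (λ x → sum (upper μ x))
                                                     ≡⟨ cong₂ _+_ totalMass≡sum totalMass≡sum ⟨
    totalMass + totalMass                            ∎
    where open ≡-Reasoning

module _ {μ : Mass n} (μ-prob : IsProbMass n μ) where

  upper-nonneg : ∀ x y → 0ℚ ≤ upper μ x y
  upper-nonneg x y with x <? y
  ... | yes x<y rewrite dec-true (x <? y) x<y  = proj₁ μ-prob x y x<y
  ... | no x≮y  rewrite dec-false (x <? y) x≮y = ≤-refl

  ifDistinct-edge-nonneg : ∀ x y → 0ℚ ≤ ifDistinct x y (edge μ x y)
  ifDistinct-edge-nonneg x y =
    subst (0ℚ ≤_) (sym (ifDistinct-edge≡upper+upper μ x y))
          (+-mono-≤ (upper-nonneg x y) (upper-nonneg y x))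

  μbar-nonneg : ∀ x → 0ℚ ≤ μbar μ x
  μbar-nonneg x = subst (0ℚ ≤_) (sym (Σ≡sum (λ y → ifDistinct x y (edge μ x y))))
    (sum-nonneg _ (ifDistinct-edge-nonneg x))

  μbar≤1 : ∀ x → μbar μ x ≤ 1ℚ
  μbar≤1 x = begin
    μbar μ x                                     ≡⟨ μbar≡row+column μ x ⟩
    sum (upper μ x) + sum (λ a → upper μ a x)    ≤⟨ row+column≤sum (upper μ) upper-nonneg x (upper-diagonal μ x) ⟩
    sum (λ a → sum (upper μ a))                  ≡⟨ totalMass≡sum μ ⟨
    totalMass μ                                  ≡⟨ proj₂ μ-prob ⟩
    1ℚ                                           ∎
    where open ≤-Reasoning

  βP2-summand≤edge : ∀ x y → ifDistinct x y (μbar μ x * edge μ x y * μbar μ y) ≤ ifDistinct x y (edge μ x y)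
  βP2-summand≤edge x y with x ≟ y | ifDistinct-edge-nonneg x y
  ... | yes _ | _      = ≤-refl
  ... | no _  | edge≥0 = p*q*r≤q (μbar-nonneg x) (μbar≤1 x) edge≥0 (μbar-nonneg y) (μbar≤1 y)

  βP2≤2 : βP2 n μ ≤ 2ℚ
  βP2≤2 = begin
    βP2 n μ                    ≤⟨ Σ-mono-≤ _ _ (λ x → Σ-mono-≤ _ _ (βP2-summand≤edge x)) ⟩
    Σ[ n ] (μbar μ)            ≡⟨ handshake μ ⟩
    totalMass μ + totalMass μ  ≡⟨ cong₂ _+_ (proj₂ μ-prob) (proj₂ μ-prob) ⟩
    2ℚ                         ∎
    where open ≤-Reasoning

p-q<p : ∀ p {q} → 0ℚ < q → p - q < p
p-q<p p q>0 = subst (p - _ <_) (+-identityʳ p) (+-monoʳ-< p (neg-antimono-< q>0))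

singleEdge : Mass 2
singleEdge _ _ = 1ℚ

singleEdge-isProbMass : IsProbMass 2 singleEdge
singleEdge-isProbMass = (λ _ _ _ → nonNegative⁻¹ 1ℚ) , refl

βP2-singleEdge : βP2 2 singleEdge ≡ 2ℚ
βP2-singleEdge = refl

proposition3p1 : ((n : ℕ) (μ : Mass n) → IsProbMass n μ → βP2 n μ ≤ 2ℚ)
    × ((ε : ℚ) → 0ℚ < ε →
        Σ ℕ (λ n → Σ (Mass n) (λ μ → IsProbMass n μ × (2ℚ - ε < βP2 n μ))))
proposition3p1 =
    (λ _ _ μ-prob → βP2≤2 μ-prob)
  , (λ ε ε>0 → 2 , singleEdge , singleEdge-isProbMass
             , subst (2ℚ - ε <_) (sym βP2-singleEdge) (p-q<p 2ℚ ε>0))
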